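{- Let $n$ be a power of $2$, let $P=\{C_l: l\in L\}$ be a partition of the set of odd-weight binary vectors of length $n$ into extended perfect codes, $\pi$ a permutation of $L$, and $D_P=\bigcup_{l\in L}C_l\times C_{\pi(l)}$. Let $(X,Y)\in D_P$ with $X\in C_k$, and let $i\neq j$ be among the first $n$ coordinates. Then $R_{ij}(C_k,X)\times\{Y\}\subseteq R_{ij}(D_P,(X,Y))$.
   Context: An extended perfect code of length $n$ is a binary code of length $n$ with minimum distance $4$ and $2^n/(2n)$ codewords. A vector of $D_P$ is a pair $(X,Y)$ whose first $n$ coordinates are those of $X$. For a code $D$ and codewords, two codewords are $ij$-adjacent if they are at Hamming distance $4$ and differ in coordinates $i$ and $j$; the $ij$-component $R_{ij}(D,X)$ is the set of codewords of $D$ joined to $X$ by a path of successive $ij$-adjacent codewords. -}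

module Defs where

open import Data.Bool using (Bool; true; false)
open import Data.Nat using (ℕ; zero; suc; _+_; _*_; _^_; _≥_)
open import Data.Nat.DivMod using (_%_)
open import Data.Fin using (Fin; _↑ˡ_)
open import Data.Vec using (Vec; []; _∷_; lookup; take; drop; _++_)
open import Data.List as List using (List; length; filter; map; concatMap)
open import Data.Product using (Σ; _×_; ∃; ∃-syntax)
open import Function.Bundles using (_↔_; Inverse)
open import Relation.Binary.PropositionalEquality using (_≡_; _≢_)
open import Relation.Binary.Construct.Closure.ReflexiveTransitive using (Star)
open import Relation.Nullary using (¬_)
open import Data.Bool using (_≟_)

Word : ℕ → Set
Word n = Vec Bool n

Code : ℕ → Set
Code n = Word n → Bool

_∈C_ : ∀ {n} → Word n → Code n → Set
X ∈C C = C X ≡ true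

allWords : (n : ℕ) → List (Word n)
allWords zero = [] List.∷ List.[]
allWords (suc n) = concatMap (λ v → (false ∷ v) List.∷ (true ∷ v) List.∷ List.[]) (allWords n)

card : ∀ {n} → Code n → ℕ
card {n} C = length (filter (λ X → C X ≟ true) (allWords n))

weight : ∀ {n} → Word n → ℕ
weight [] = 0
weight (false ∷ v) = weight v
weight (true ∷ v) = suc (weight v)

dist : ∀ {n} → Word n → Word n → ℕ
dist [] [] = 0
dist (a ∷ u) (b ∷ v) with a ≟ b
... | Relation.Nullary.yes _ = dist u v
... | Relation.Nullary.no _ = suc (dist u v)

OddWeight : ∀ {n} → Word n → Set
OddWeight X = weight X % 2 ≡ 1

IsPowerOf2 : ℕ → Set
IsPowerOf2 n = ∃[ m ] n ≡ 2 ^ m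

-- Extended perfect code of length n: minimum distance 4 and 2^n/(2n) codewords
-- (the cardinality condition written as |C| * (2n) = 2^n).
record IsExtendedPerfect {n : ℕ} (C : Code n) : Set where
  field
    minDist : ∀ X Y → X ∈C C → Y ∈C C → X ≢ Y → dist X Y ≥ 4
    size    : card C * (2 * n) ≡ 2 ^ n

record IsOddPartition {n : ℕ} (L : Set) (C : L → Code n) : Set where
  field
    perfect  : ∀ l → IsExtendedPerfect (C l)
    odd      : ∀ l X → X ∈C C l → OddWeight X
    covers   : ∀ X → OddWeight X → ∃[ l ] X ∈C C l
    disjoint : ∀ l l′ X → X ∈C C l → X ∈C C l′ → l ≡ l′

-- D_P = ⋃_l C_l × C_{π(l)}, as a set of words of length n + n
-- (a word Z corresponds to the pair (take n Z, drop n Z))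
DP : ∀ {n} {L : Set} → (L → Code n) → (π : L ↔ L) → Word (n + n) → Set
DP {n} {L} C π Z = ∃[ l ] (take n Z ∈C C l × drop n Z ∈C C (Inverse.to π l))

Adj : ∀ {N} → Fin N → Fin N → Word N → Word N → Set
Adj i j A B = dist A B ≡ 4 × lookup A i ≢ lookup B i × lookup A j ≢ lookup B j

-- Z ∈ R_ij(D, X): Z ∈ D joined to X by a path of successive ij-adjacent codewords of D
InComp : ∀ {N} → (Word N → Set) → Fin N → Fin N → Word N → Word N → Set
InComp D i j X Z = D Z × Star (λ A B → D A × D B × Adj i j A B) X Z

module Submission where

-- Whether (X, Y) lies in D_P depends only on the class of X: by disjointness of the partition,
-- X ∈ C_k forces Y ∈ C_π(k), and then (V, Y) ∈ D_P for every V ∈ C_k. Appending the fixed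
-- suffix Y changes neither distances nor the coordinates in which two words differ, so an
-- ij-path in C_k becomes an ij-path in D_P.

open import Defs
open import Data.Bool using (_≟_)
open import Data.Empty using (⊥-elim)
open import Data.Nat using (ℕ; suc; _+_)
open import Data.Fin using (Fin; _↑ˡ_)
open import Data.Vec using (Vec; []; _∷_; _++_; take; drop; lookup)
open import Data.Vec.Properties using (take++drop≡id; ++-injectiveˡ; ++-injectiveʳ; lookup-++ˡ)
open import Data.Product using (_,_)
open import Function.Bundles using (_↔_; Inverse)
open import Relation.Binary.PropositionalEquality using (_≡_; _≢_; refl; sym; trans; subst; cong)
open import Relation.Binary.Construct.Closure.ReflexiveTransitive using (gmap)
open import Relation.Nullary using (yes; no)

take-++ : ∀ {A : Set} {m n} (xs : Vec A m) (ys : Vec A n) → take m (xs ++ ys) ≡ xs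
take-++ {m = m} xs ys = ++-injectiveˡ _ _ (take++drop≡id m (xs ++ ys))

drop-++ : ∀ {A : Set} {m n} (xs : Vec A m) (ys : Vec A n) → drop m (xs ++ ys) ≡ ys
drop-++ {m = m} xs ys = ++-injectiveʳ _ _ (take++drop≡id m (xs ++ ys))

dist-refl : ∀ {n} (x : Word n) → dist x x ≡ 0
dist-refl [] = refl
dist-refl (a ∷ x) with a ≟ a
... | yes _  = dist-refl x
... | no a≢a = ⊥-elim (a≢a refl)

dist-++ʳ : ∀ {m n} (a b : Word m) (y : Word n) → dist (a ++ y) (b ++ y) ≡ dist a b
dist-++ʳ [] [] y = dist-refl y
dist-++ʳ (a ∷ as) (b ∷ bs) y with a ≟ b
... | yes _ = dist-++ʳ as bs y
... | no _  = cong suc (dist-++ʳ as bs y)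

lookup-++ʳ-≢ : ∀ {m n} (A B : Word m) (Y : Word n) (i : Fin m) →
  lookup A i ≢ lookup B i → lookup (A ++ Y) (i ↑ˡ n) ≢ lookup (B ++ Y) (i ↑ˡ n)
lookup-++ʳ-≢ A B Y i A≢B eq = A≢B (trans (sym (lookup-++ˡ A Y i)) (trans eq (lookup-++ˡ B Y i)))

Adj-++ʳ : ∀ {m n} {i j : Fin m} (A B : Word m) (Y : Word n) →
  Adj i j A B → Adj (i ↑ˡ n) (j ↑ˡ n) (A ++ Y) (B ++ Y)
Adj-++ʳ {i = i} {j} A B Y (d≡4 , A≢Bᵢ , A≢Bⱼ) =
  trans (dist-++ʳ A B Y) d≡4 , lookup-++ʳ-≢ A B Y i A≢Bᵢ , lookup-++ʳ-≢ A B Y j A≢Bⱼ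

InComp-++ʳ : ∀ {m n} {D : Word m → Set} {D′ : Word (m + n) → Set} (Y : Word n) →
  (∀ {V} → D V → D′ (V ++ Y)) →
  ∀ {i j X Z} → InComp D i j X Z → InComp D′ (i ↑ˡ n) (j ↑ˡ n) (X ++ Y) (Z ++ Y)
InComp-++ʳ Y lift (Z∈D , path) =
  lift Z∈D , gmap (_++ Y) (λ {A} {B} (A∈D , B∈D , adj) → lift A∈D , lift B∈D , Adj-++ʳ A B Y adj) path

module _ {n} {L : Set} {C : L → Code n} (P : IsOddPartition L C) (π : L ↔ L) where

  open Inverse π using (to)

  DP-partner : ∀ {X Y k} → DP C π (X ++ Y) → X ∈C C k → Y ∈C C (to k)
  DP-partner {X} {Y} {k} (l , X∈Cₗ , Y∈Cπₗ) X∈Cₖ =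
    subst (λ l′ → Y ∈C C (to l′)) l≡k (subst (λ W → W ∈C C (to l)) (drop-++ X Y) Y∈Cπₗ)
    where
    l≡k : l ≡ k
    l≡k = IsOddPartition.disjoint P l k X (subst (λ W → W ∈C C l) (take-++ X Y) X∈Cₗ) X∈Cₖ

  DP-++ : ∀ {V Y k} → V ∈C C k → Y ∈C C (to k) → DP C π (V ++ Y)
  DP-++ {V} {Y} {k} V∈Cₖ Y∈Cπₖ =
    k , subst (λ W → W ∈C C k) (sym (take-++ V Y)) V∈Cₖ
      , subst (λ W → W ∈C C (to k)) (sym (drop-++ V Y)) Y∈Cπₖ

mainTheorem7 : (n : ℕ) → IsPowerOf2 n → (L : Set) → (C : L → Code n) → IsOddPartition L C →
    (π : L ↔ L) → (X Y : Word n) → (k : L) → DP C π (X ++ Y) → X ∈C C k →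
    (i j : Fin n) → i ≢ j →
    ∀ Z → InComp (λ V → V ∈C C k) i j X Z →
    InComp (DP C π) (i ↑ˡ n) (j ↑ˡ n) (X ++ Y) (Z ++ Y)
mainTheorem7 n _ L C P π X Y k XY∈D X∈Cₖ i j _ Z =
  InComp-++ʳ Y (λ V∈Cₖ → DP-++ P π V∈Cₖ Y∈Cπₖ)
  where
  Y∈Cπₖ : Y ∈C C (Inverse.to π k)
  Y∈Cπₖ = DP-partner P π XY∈D X∈Cₖ
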